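{- The center number of a tree $T$ on $n$ vertices is $cn(T)=2n-1$.
   Context: $d$ is shortest-path distance. For nonempty $S\subseteq V$, $e_S(v)=\max_{x\in S}d(v,x)$ and $C_S(G)=\{v\in V: e_S(v)\le e_S(x)\ \forall x\in V\}$. A set $A\subseteq V$ is a center set of $G$ if $A=C_S(G)$ for some nonempty $S\subseteq V$; the center number $cn(G)$ is the number of distinct center sets of $G$. -}

module Defs where

open import Data.Nat using (ℕ; zero; suc; _≤_)
open import Data.Fin using (Fin)
open import Data.Fin.Subset using (Subset; _∈_; Nonempty)
open import Data.List using (List; []; _∷_; _++_; length)
open import Data.List.Relation.Unary.Unique.Propositional using (Unique)
import Data.List.Membership.Propositional as LM
open import Data.Product using (Σ; _×_; ∃; ∃-syntax)
open import Data.Empty using (⊥)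
open import Function.Bundles using (_⇔_)
open import Relation.Nullary using (¬_)
open import Relation.Binary.PropositionalEquality using (_≡_)

record Graph (n : ℕ) : Set₁ where
  field
    Adj     : Fin n → Fin n → Set
    symAdj  : ∀ {u v} → Adj u v → Adj v u
    irrefl  : ∀ {u} → ¬ Adj u u
open Graph public

module _ {n : ℕ} (G : Graph n) where

  data Walk : Fin n → Fin n → ℕ → Set where
    here : ∀ {u} → Walk u u 0
    step : ∀ {u w v k} → Adj G u w → Walk w v k → Walk u v (suc k)

  data Chain : List (Fin n) → Set where
    chain[]  : Chain []
    chain[-] : ∀ {x} → Chain (x ∷ [])
    chain∷   : ∀ {x y xs} → Adj G x y → Chain (y ∷ xs) → Chain (x ∷ y ∷ xs)

  HasCycle : Set
  HasCycle = Σ (Fin n) λ v → Σ (List (Fin n)) λ rest →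
    (2 ≤ length rest) × Unique (v ∷ rest) × Chain (v ∷ rest ++ v ∷ [])

  Connected : Set
  Connected = ∀ u v → ∃[ k ] Walk u v k

  IsTree : Set
  IsTree = Connected × ¬ HasCycle

  Dist : Fin n → Fin n → ℕ → Set
  Dist u v k = Walk u v k × (∀ j → Walk u v j → k ≤ j)

  Ecc : Subset n → Fin n → ℕ → Set
  Ecc S v e =
    (∀ x → x ∈ S → ∀ k → Dist v x k → k ≤ e) ×
    (∃[ x ] (x ∈ S × Dist v x e))

  InCenter : Subset n → Fin n → Set
  InCenter S v = ∀ x ev ex → Ecc S v ev → Ecc S x ex → ev ≤ ex

  IsCenterOf : Subset n → Subset n → Set
  IsCenterOf S A = ∀ v → (v ∈ A ⇔ InCenter S v)

  IsCenterSet : Subset n → Set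
  IsCenterSet A = Σ (Subset n) λ S → Nonempty S × IsCenterOf S A

  CenterNumber : ℕ → Set
  CenterNumber k = Σ (List (Subset n)) λ L →
    Unique L × (length L ≡ k) × (∀ A → (A LM.∈ L) ⇔ IsCenterSet A)

-- Every center set of a tree is a single vertex or the two ends of an edge, and each of these
-- is the center set of itself; a tree on n ≥ 1 vertices has n − 1 edges, so there are
-- n + (n − 1) center sets.
--
-- The heart is that two central vertices x, y are never at distance ≥ 2.  Let z be the
-- neighbour of x on a geodesic to y and root the tree at a vertex s ∈ S farthest from z.
-- Depths along a geodesic can fall and then rise but never rise and then fall, since the
-- top vertex would have two parents.  Hence z is strictly shallower than x or y, say than x,
-- and e_S(z) = d(z, s) < d(x, s) ≤ e_S(x), contradicting centrality of x.
module Submission where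

open import Defs
open import Data.Empty using (⊥; ⊥-elim)
open import Data.Fin using (Fin; zero; suc) renaming (_≟_ to _≟ᶠ_)
import Data.Fin.Properties as Fin
open import Data.Fin.Properties using (any?)
open import Data.Fin.Subset using (Subset; _∈_; _⊆_; _∪_; ⁅_⁆; Nonempty)
open import Data.Fin.Subset.Properties
  using (_∈?_; x∈⁅x⁆; x∈⁅y⁆⇒x≡y; x∈⁅y⁆⇔x≡y; x∈p∪q⁺; x∈p∪q⁻; ⊆-antisym; ∪-comm)
open import Data.List using (List; []; _∷_; _++_; _∷ʳ_; length; map; filter; allFin)
open import Data.List.Extrema.Nat using (argmax; argmin; argmax-all; f[xs]≤f[argmax]; f[argmin]≤f[xs])
open import Data.List.Membership.Propositional using () renaming (_∈_ to _∈ₗ_)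
open import Data.List.Membership.Propositional.Properties
  using (∈-filter⁺; ∈-allFin; ∈-map⁺; ∈-map⁻; ∈-++⁺ˡ; ∈-++⁺ʳ; ∈-++⁻)
open import Data.List.Properties using (length-++; length-map; length-tabulate)
open import Data.List.Relation.Unary.All using (All; []; _∷_; head)
import Data.List.Relation.Unary.All as All
import Data.List.Relation.Unary.All.Properties as Allₚ
open import Data.List.Relation.Unary.AllPairs using ([]; _∷_)
open import Data.List.Relation.Unary.Any using (here; there)
import Data.List.Relation.Unary.Any as Any
open import Data.List.Relation.Unary.Unique.Propositional using (Unique)
import Data.List.Relation.Unary.Unique.Propositional.Properties as Uniqueₚ
open import Data.Nat using (ℕ; zero; suc; _+_; _*_; _∸_; _≤_; _<_; z≤n; s≤s)
open import Data.Nat.Properties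
  using ( ≤-refl; ≤-trans; ≤-antisym; ≤-pred; ≤-reflexive; ≮⇒≥; m<1+n⇒m<n∨m≡n; n≤1+n; n≤0⇒n≡0
        ; <-irrefl; <-cmp; m≤n+m; +-suc; +-identityʳ; suc-injective; n≢0⇒n>0; m≢1+n+m; 0≢1+n)
open import Data.Product using (∃; ∃₂; _×_; _,_; proj₁; proj₂)
import Data.Product as Product
open import Data.Sum using (_⊎_; inj₁; inj₂; [_,_]′)
import Data.Sum as Sum
open import Function.Base using (id)
open import Function.Bundles using (_⇔_; mk⇔; Equivalence)
open import Relation.Binary.Definitions using (tri<; tri≈; tri>)
open import Relation.Binary.PropositionalEquality
  using (_≡_; _≢_; ≢-sym; refl; sym; trans; cong; cong₂; subst; subst₂; module ≡-Reasoning)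
open import Relation.Nullary using (¬_; Dec; yes; no; contradiction)
open import Relation.Nullary.Decidable using (_×-dec_; ¬?)

module _ {p} {P : ℕ → Set p} (P? : ∀ i → Dec (P i)) where

  search-below : ∀ b → (∀ {i} → i < b → ¬ P i) ⊎ ∃ λ j → P j × (∀ i → P i → j ≤ i)
  search-below zero = inj₁ λ ()
  search-below (suc b) with search-below b
  ... | inj₂ least = inj₂ least
  ... | inj₁ none with P? b
  ...   | yes pb = inj₂ (b , pb , λ i pi → ≮⇒≥ λ i<b → none i<b pi)
  ...   | no ¬pb = inj₁ λ i<1+b pi →
          [ (λ i<b → none i<b pi) , (λ { refl → ¬pb pi }) ]′ (m<1+n⇒m<n∨m≡n i<1+b)

  least-witness : ∀ {k} → P k → ∃ λ j → P j × (∀ i → P i → j ≤ i)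
  least-witness {k} pk with search-below (suc k)
  ... | inj₁ none  = contradiction pk (none ≤-refl)
  ... | inj₂ least = least

module _ {n : ℕ} (G : Graph n) where

  private variable
    u v w x : Fin n
    k : ℕ

  adj⇒≢ : Adj G u v → u ≢ v
  adj⇒≢ a refl = irrefl G a

  snocWalk : Walk G u v k → Adj G v w → Walk G u w (suc k)
  snocWalk here       a = step a here
  snocWalk (step b p) a = step b (snocWalk p a)

  reverseWalk : Walk G u v k → Walk G v u k
  reverseWalk here       = here
  reverseWalk (step a p) = snocWalk (reverseWalk p) (symAdj G a)

  vertices : Walk G u v k → List (Fin n)
  vertices {u} here       = u ∷ []
  vertices {u} (step _ p) = u ∷ vertices p

  length-vertices : (p : Walk G u v k) → length (vertices p) ≡ suc k
  length-vertices here       = refl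
  length-vertices (step _ p) = cong suc (length-vertices p)

  SimpleWalk : Fin n → Fin n → Set
  SimpleWalk u v = ∃₂ λ k (p : Walk G u v k) → Unique (vertices p)

  simpleSuffix : (p : Walk G u v k) → Unique (vertices p) → x ∈ₗ vertices p → SimpleWalk x v
  simpleSuffix here       uq       (here refl)  = _ , here , uq
  simpleSuffix (step a p) uq       (here refl)  = _ , step a p , uq
  simpleSuffix (step _ p) (_ ∷ uq) (there x∈p) = simpleSuffix p uq x∈p

  -- If u reappears on the simplified tail, the loop back to it is dropped.
  toSimpleWalk : Walk G u v k → SimpleWalk u v
  toSimpleWalk here = 0 , here , [] ∷ []
  toSimpleWalk {u} (step a p) with toSimpleWalk p
  ... | _ , q , uq with Any.any? (u ≟ᶠ_) (vertices q)
  ...   | yes u∈q = simpleSuffix q uq u∈q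
  ...   | no  u∉q = _ , step a q , Allₚ.¬Any⇒All¬ (vertices q) u∉q ∷ uq

  chain-snocWalk : (p : Walk G u v k) → Adj G v w → Chain G (vertices p ∷ʳ w)
  chain-snocWalk here                a = chain∷ a chain[-]
  chain-snocWalk (step b here)       a = chain∷ b (chain∷ a chain[-])
  chain-snocWalk (step b (step c p)) a = chain∷ b (chain-snocWalk (step c p) a)

  chain-∷ʳ : ∀ xs → Chain G (xs ∷ʳ v) → Adj G v w → Chain G (xs ∷ʳ v ∷ʳ w)
  chain-∷ʳ []           _             a = chain∷ a chain[-]
  chain-∷ʳ (_ ∷ [])     (chain∷ b ch) a = chain∷ b (chain-∷ʳ [] ch a)
  chain-∷ʳ (_ ∷ y ∷ xs) (chain∷ b ch) a = chain∷ b (chain-∷ʳ (y ∷ xs) ch a)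

  unique-∷ʳ : ∀ {xs} → Unique xs → All (v ≢_) xs → Unique (xs ∷ʳ v)
  unique-∷ʳ []        []          = [] ∷ []
  unique-∷ʳ (x∉ ∷ uq) (v≢x ∷ v∉) = Allₚ.∷ʳ⁺ x∉ (≢-sym v≢x) ∷ unique-∷ʳ uq v∉

  module _ (adj? : ∀ u v → Dec (Adj G u v)) where

    walk? : ∀ k u v → Dec (Walk G u v k)
    walk? zero u v with u ≟ᶠ v
    ... | yes refl = yes here
    ... | no  u≢v  = no λ { here → u≢v refl }
    walk? (suc k) u v with any? (λ w → adj? u w ×-dec walk? k w v)
    ... | yes (_ , a , p) = yes (step a p)
    ... | no  ∄w          = no λ { (step a p) → ∄w (_ , a , p) }

    distance : Connected G → ∀ u v → ∃ (Dist G u v)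
    distance conn u v = least-witness (λ k → walk? k u v) (proj₂ (conn u v))

⁅⁆-injective : ∀ {n} {u v : Fin n} → ⁅ u ⁆ ≡ ⁅ v ⁆ → u ≡ v
⁅⁆-injective {u = u} {v} eq = x∈⁅y⁆⇒x≡y v (subst (u ∈_) eq (x∈⁅x⁆ u))

-- Opaque so that unification can read u and v off edge u v.
opaque
  edge : ∀ {n} → Fin n → Fin n → Subset n
  edge u v = ⁅ u ⁆ ∪ ⁅ v ⁆

  edge-comm : ∀ {n} (u v : Fin n) → edge u v ≡ edge v u
  edge-comm u v = ∪-comm ⁅ u ⁆ ⁅ v ⁆

  ∈edge⁻ : ∀ {n} {u v x : Fin n} → x ∈ edge u v → x ≡ u ⊎ x ≡ v
  ∈edge⁻ {u = u} {v} x∈ =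
    Sum.map (x∈⁅y⁆⇒x≡y u) (x∈⁅y⁆⇒x≡y v) (x∈p∪q⁻ ⁅ u ⁆ ⁅ v ⁆ x∈)

  ∈edge⁺ : ∀ {n} {u v x : Fin n} → x ≡ u ⊎ x ≡ v → x ∈ edge u v
  ∈edge⁺ {u = u} (inj₁ refl) = x∈p∪q⁺ (inj₁ (x∈⁅x⁆ u))
  ∈edge⁺ {v = v} (inj₂ refl) = x∈p∪q⁺ (inj₂ (x∈⁅x⁆ v))

module Tree {n : ℕ} (T : Graph n) (tree : IsTree T) where

  private variable
    u v w x y z : Fin n
    k m e : ℕ

  connected : Connected T
  connected = proj₁ tree

  acyclic : ¬ HasCycle T
  acyclic = proj₂ tree

  no-triangle : Adj T u v → Adj T v w → Adj T w u → ⊥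
  no-triangle {u} {v} {w} uv vw wu = acyclic (u , v ∷ w ∷ [] , s≤s (s≤s z≤n) ,
    (adj⇒≢ T uv ∷ ≢-sym (adj⇒≢ T wu) ∷ []) ∷ (adj⇒≢ T vw ∷ []) ∷ [] ∷ [] ,
    chain∷ uv (chain∷ vw (chain∷ wu chain[-])))

  -- A simple walk of length ≥ 2 from u to v closes a cycle with an edge v u.
  adj? : ∀ u v → Dec (Adj T u v)
  adj? u v with toSimpleWalk T (proj₂ (connected u v))
  ... | 0 , here , _          = no (irrefl T)
  ... | 1 , step a here , _   = yes a
  ... | suc (suc _) , step a (step b p) , uq = no λ vu → acyclic
          (u , vertices T (step b p) ,
           subst (2 ≤_) (sym (length-vertices T (step b p))) (s≤s (s≤s z≤n)) ,
           uq , chain-snocWalk T (step a (step b p)) (symAdj T vu))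

  -- Opaque (like farthest and c below): unfolding the search behind it makes type checking blow up.
  opaque
    dist : Fin n → Fin n → ℕ
    dist u v = proj₁ (distance T adj? connected u v)

    Dist-dist : Dist T u v (dist u v)
    Dist-dist {u} {v} = proj₂ (distance T adj? connected u v)

  dist-walk : Walk T u v (dist u v)
  dist-walk = proj₁ Dist-dist

  dist-minimal : Walk T u v k → dist u v ≤ k
  dist-minimal p = proj₂ Dist-dist _ p

  Dist⇒≡dist : Dist T u v k → k ≡ dist u v
  Dist⇒≡dist (p , minimal) = ≤-antisym (minimal _ dist-walk) (dist-minimal p)

  dist≡0⇒≡ : dist u v ≡ 0 → u ≡ v
  dist≡0⇒≡ {u} {v} eq with subst (Walk T u v) eq dist-walk
  ... | here = refl

  dist≡1⇒adj : dist u v ≡ 1 → Adj T u v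
  dist≡1⇒adj {u} {v} eq with subst (Walk T u v) eq dist-walk
  ... | step a here = a

  dist≤1⇒adj : u ≢ v → dist u v ≤ 1 → Adj T u v
  dist≤1⇒adj {u} {v} u≢v d≤1 with dist u v in eq
  ... | 0           = contradiction (dist≡0⇒≡ eq) u≢v
  ... | 1           = dist≡1⇒adj eq
  ... | suc (suc _) = contradiction d≤1 λ { (s≤s ()) }

  dist-self : dist u u ≡ 0
  dist-self = n≤0⇒n≡0 (dist-minimal here)

  dist-adj : Adj T u v → dist u v ≤ 1
  dist-adj a = dist-minimal (step a here)

  dist-step : Adj T w x → dist w z ≤ suc (dist x z)
  dist-step a = dist-minimal (step a dist-walk)

  next-hop : dist w z ≡ suc k → ∃ λ x → Adj T w x × dist x z ≡ k
  next-hop {w} {z} eq with subst (Walk T w z) eq dist-walk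
  ... | step {w = x} a p =
    x , a , ≤-antisym (dist-minimal p) (≤-pred (subst (_≤ suc (dist x z)) eq (dist-step a)))

  module Levels (s : Fin n) where

    depth : Fin n → ℕ
    depth w = dist w s

    ≢-deeper : depth x ≡ m → ∀ {xs} → All (λ r → suc m ≤ depth r) xs → All (x ≢_) xs
    ≢-deeper dx = All.map λ { lt refl → <-irrefl (sym dx) lt }

    -- A simple chain cannot have both ends at its minimum depth: moving both ends down towards s
    -- in lockstep keeps it simple until the two next hops coincide (at the latest at s),
    -- and then they close a cycle.
    no-arch : ∀ m b c R → depth b ≡ m → depth c ≡ m →
              All (λ r → m ≤ depth r) (b ∷ R ++ c ∷ []) →
              Unique (b ∷ R ++ c ∷ []) → Chain T (b ∷ R ++ c ∷ []) → ⊥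
    no-arch zero b c R db dc _ (b∉ ∷ _) _ =
      head (Allₚ.++⁻ʳ R b∉) (trans (dist≡0⇒≡ db) (sym (dist≡0⇒≡ dc)))
    no-arch (suc m) b c R db dc deep uq ch with next-hop db | next-hop dc
    ... | b′ , bb′ , db′ | c′ , cc′ , dc′ with b′ ≟ᶠ c′
    ...   | yes refl = acyclic (b′ , b ∷ R ++ c ∷ [] , s≤s longer , ≢-deeper db′ deep ∷ uq ,
                               chain∷ (symAdj T bb′) (chain-∷ʳ T (b ∷ R) ch cc′))
      where
      longer : 1 ≤ length (R ++ c ∷ [])
      longer = subst (1 ≤_) (sym (length-++ R)) (m≤n+m 1 (length R))
    ...   | no b′≢c′ = no-arch m b′ c′ (b ∷ R ++ c ∷ []) db′ dc′
              (≤-reflexive (sym db′) ∷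
                 Allₚ.∷ʳ⁺ (All.map (≤-trans (n≤1+n m)) deep) (≤-reflexive (sym dc′)))
              (Allₚ.∷ʳ⁺ (≢-deeper db′ deep) b′≢c′ ∷ unique-∷ʳ T uq (≢-deeper dc′ deep))
              (chain∷ (symAdj T bb′) (chain-∷ʳ T (b ∷ R) ch cc′))

    adjacent-depths-differ : Adj T u v → depth u ≢ depth v
    adjacent-depths-differ {u} {v} a eq = no-arch (depth u) u v [] refl (sym eq)
      (≤-refl ∷ ≤-reflexive eq ∷ []) ((adj⇒≢ T a ∷ []) ∷ [] ∷ []) (chain∷ a chain[-])

    parent-unique : Adj T v x → Adj T v y → depth x ≡ m → depth y ≡ m → depth v ≡ suc m →
                    x ≡ y
    parent-unique {v} {x} {y} {m} vx vy dx dy dv with x ≟ᶠ y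
    ... | yes x≡y = x≡y
    ... | no  x≢y = ⊥-elim (no-arch m x y (v ∷ []) dx dy
          (≤-reflexive (sym dx) ∷ ≤-trans (n≤1+n m) (≤-reflexive (sym dv)) ∷
           ≤-reflexive (sym dy) ∷ [])
          ((adj⇒≢ T (symAdj T vx) ∷ x≢y ∷ []) ∷ (adj⇒≢ T vy ∷ []) ∷ [] ∷ [])
          (chain∷ (symAdj T vx) (chain∷ vy chain[-])))

    depth-step : Adj T u v → depth v ≡ suc (depth u) ⊎ depth u ≡ suc (depth v)
    depth-step {u} {v} a with <-cmp (depth u) (depth v)
    ... | tri< lt _ _ = inj₁ (≤-antisym (dist-step (symAdj T a)) lt)
    ... | tri≈ _ eq _ = contradiction eq (adjacent-depths-differ a)
    ... | tri> _ _ gt = inj₂ (≤-antisym (dist-step a) gt)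

    -- Turning back down would give the turning vertex two parents.
    geodesic-climbs : (a : Adj T w x) (p : Walk T x y k) → (∀ j → Walk T w y j → suc k ≤ j) →
                      depth x ≡ suc (depth w) → depth y ≡ k + depth x
    geodesic-climbs a here _ _ = refl
    geodesic-climbs {w} {x} a (step {w = x′} b p) shortest up with depth-step b
    ... | inj₁ up′ = trans (geodesic-climbs b p (λ j q → ≤-pred (shortest (suc j) (step a q))) up′)
                           (trans (cong (_ +_) up′) (+-suc _ (depth x)))
    ... | inj₂ down with parent-unique (symAdj T a) b refl (suc-injective (trans (sym down) up)) up
    ...   | refl = contradiction (shortest _ p) λ lt → <-irrefl refl (≤-trans (n≤1+n _) lt)

    geodesic-interior-lower : (a : Adj T x z) (p : Walk T z y (suc k)) →
                              (∀ j → Walk T x y j → suc (suc k) ≤ j) →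
                              depth z < depth x ⊎ depth z < depth y
    geodesic-interior-lower {z = z} {k = k} a p shortest with depth-step a
    ... | inj₂ down = inj₁ (≤-reflexive (sym down))
    ... | inj₁ up   =
      inj₂ (subst (depth z <_) (sym (geodesic-climbs a p shortest up)) (s≤s (m≤n+m (depth z) k)))

  module Eccentricity (S : Subset n) (nonempty : Nonempty S) where

    opaque
      farthest : Fin n → Fin n
      farthest v = argmax (dist v) (proj₁ nonempty) (filter (_∈? S) (allFin n))

      farthest-∈ : farthest v ∈ S
      farthest-∈ {v} = argmax-all (dist v) (proj₂ nonempty) (Allₚ.all-filter (_∈? S) (allFin n))

      farthest-max : y ∈ S → dist v y ≤ dist v (farthest v)
      farthest-max {y} {v} y∈S =
        All.lookup (f[xs]≤f[argmax] (proj₁ nonempty) (filter (_∈? S) (allFin n)))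
                   (∈-filter⁺ (_∈? S) (∈-allFin y) y∈S)

    ecc : Fin n → ℕ
    ecc v = dist v (farthest v)

    Ecc-ecc : Ecc T S v (ecc v)
    Ecc-ecc = (λ y y∈S _ D → subst (_≤ _) (sym (Dist⇒≡dist D)) (farthest-max y∈S)) ,
              _ , farthest-∈ , Dist-dist

    Ecc⇒≡ecc : Ecc T S v e → e ≡ ecc v
    Ecc⇒≡ecc (bounded , y , y∈S , D) =
      ≤-antisym (subst (_≤ _) (sym (Dist⇒≡dist D)) (farthest-max y∈S))
                (bounded _ farthest-∈ _ Dist-dist)

    inCenter⇔ecc-minimal : InCenter T S v ⇔ (∀ x → ecc v ≤ ecc x)
    inCenter⇔ecc-minimal = mk⇔ (λ central x → central x _ _ Ecc-ecc Ecc-ecc)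
      λ minimal x _ _ Ev Ex → subst₂ _≤_ (sym (Ecc⇒≡ecc Ev)) (sym (Ecc⇒≡ecc Ex)) (minimal x)

    -- The middle vertex z of a geodesic x ~ z ~ ⋯ ~ y is closer than x or y to the vertex farthest from z.
    ecc-minimal-adjacent : (∀ w → ecc x ≤ ecc w) → (∀ w → ecc y ≤ ecc w) → x ≢ y →
                           Adj T x y
    ecc-minimal-adjacent {x} {y} x-min y-min x≢y with dist x y in eq
    ... | 0           = contradiction (dist≡0⇒≡ eq) x≢y
    ... | 1           = dist≡1⇒adj eq
    ... | suc (suc k) with subst (Walk T x y) eq dist-walk
    ...   | step {w = z} a p = ⊥-elim ([ above x x-min , above y y-min ]′
                                  (geodesic-interior-lower a p λ j q → subst (_≤ j) eq (dist-minimal q)))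
      where
      open Levels (farthest z)
      above : ∀ c → (∀ w → ecc c ≤ ecc w) → depth z < depth c → ⊥
      above c c-min lt = <-irrefl refl (≤-trans lt (≤-trans (farthest-max farthest-∈) (c-min z)))

  singleton-center : ∀ v → IsCenterOf T ⁅ v ⁆ ⁅ v ⁆
  singleton-center v w = mk⇔ to from
    where
    open Eccentricity ⁅ v ⁆ (v , x∈⁅x⁆ v)
    ecc≡dist : ∀ u → ecc u ≡ dist u v
    ecc≡dist u = cong (dist u) (x∈⁅y⁆⇒x≡y v farthest-∈)
    ecc-v : ecc v ≡ 0
    ecc-v = trans (ecc≡dist v) dist-self
    to : w ∈ ⁅ v ⁆ → InCenter T ⁅ v ⁆ w
    to w∈ with x∈⁅y⁆⇒x≡y v w∈
    ... | refl = Equivalence.from inCenter⇔ecc-minimal λ x → subst (_≤ ecc x) (sym ecc-v) z≤n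
    from : InCenter T ⁅ v ⁆ w → w ∈ ⁅ v ⁆
    from central = Equivalence.from x∈⁅y⁆⇔x≡y (dist≡0⇒≡ (n≤0⇒n≡0
      (subst₂ _≤_ (ecc≡dist w) ecc-v (Equivalence.to inCenter⇔ecc-minimal central v))))

  edge-center : Adj T u v → IsCenterOf T (edge u v) (edge u v)
  edge-center {u} {v} uv w = mk⇔ to from
    where
    u∈ : u ∈ edge u v
    u∈ = ∈edge⁺ (inj₁ refl)
    v∈ : v ∈ edge u v
    v∈ = ∈edge⁺ (inj₂ refl)
    open Eccentricity (edge u v) (u , u∈)
    within-edge : x ∈ edge u v → y ∈ edge u v → dist x y ≤ 1
    within-edge x∈ y∈ with ∈edge⁻ x∈ | ∈edge⁻ y∈
    ... | inj₁ refl | inj₁ refl = ≤-trans (dist-minimal here) z≤n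
    ... | inj₁ refl | inj₂ refl = dist-adj uv
    ... | inj₂ refl | inj₁ refl = dist-adj (symAdj T uv)
    ... | inj₂ refl | inj₂ refl = ≤-trans (dist-minimal here) z≤n
    ecc-positive : ∀ x → 1 ≤ ecc x
    ecc-positive x = n≢0⇒n>0 λ ecc≡0 → adj⇒≢ T uv (trans
      (sym (dist≡0⇒≡ (n≤0⇒n≡0 (subst (dist x u ≤_) ecc≡0 (farthest-max u∈)))))
      (dist≡0⇒≡ (n≤0⇒n≡0 (subst (dist x v ≤_) ecc≡0 (farthest-max v∈)))))
    to : w ∈ edge u v → InCenter T (edge u v) w
    to w∈ = Equivalence.from inCenter⇔ecc-minimal λ x →
      ≤-trans (within-edge w∈ farthest-∈) (ecc-positive x)
    from : InCenter T (edge u v) w → w ∈ edge u v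
    from central with w ≟ᶠ u | w ≟ᶠ v
    ... | yes w≡u | _       = ∈edge⁺ (inj₁ w≡u)
    ... | no _    | yes w≡v = ∈edge⁺ (inj₂ w≡v)
    ... | no w≢u  | no w≢v  = ⊥-elim (no-triangle wu uv (symAdj T wv))
      where
      close : y ∈ edge u v → dist w y ≤ 1
      close y∈ = ≤-trans (farthest-max y∈)
        (≤-trans (Equivalence.to inCenter⇔ecc-minimal central u) (within-edge u∈ farthest-∈))
      wu : Adj T w u
      wu = dist≤1⇒adj w≢u (close u∈)
      wv : Adj T w v
      wv = dist≤1⇒adj w≢v (close v∈)

  module CenterSetShape {A : Subset n} (S : Subset n) (nonempty : Nonempty S)
                        (A-center : IsCenterOf T S A) where
    open Eccentricity S nonempty

    opaque
      c : Fin n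
      c = argmin ecc (proj₁ nonempty) (allFin n)

      c-min : ∀ x → ecc c ≤ ecc x
      c-min x = All.lookup (f[argmin]≤f[xs] (proj₁ nonempty) (allFin n)) (∈-allFin x)

    ∈A⇒min : x ∈ A → ∀ w → ecc x ≤ ecc w
    ∈A⇒min x∈A = Equivalence.to inCenter⇔ecc-minimal (Equivalence.to (A-center _) x∈A)

    c∈A : c ∈ A
    c∈A = Equivalence.from (A-center c) (Equivalence.from inCenter⇔ecc-minimal c-min)

    shape : (∃ λ c → A ≡ ⁅ c ⁆) ⊎ (∃₂ λ c y → Adj T c y × A ≡ edge c y)
    shape with any? (λ y → (y ∈? A) ×-dec ¬? (y ≟ᶠ c))
    ... | no ∄y = inj₁ (c , ⊆-antisym A⊆ λ x∈⁅c⁆ → subst (_∈ A) (sym (x∈⁅y⁆⇒x≡y c x∈⁅c⁆)) c∈A)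
      where
      A⊆ : A ⊆ ⁅ c ⁆
      A⊆ {x} x∈A with x ≟ᶠ c
      ... | yes x≡c = Equivalence.from x∈⁅y⁆⇔x≡y x≡c
      ... | no  x≢c = ⊥-elim (∄y (x , x∈A , x≢c))
    ... | yes (y , y∈A , y≢c) = inj₂ (c , y , cy , ⊆-antisym A⊆ ⊆A)
      where
      cy : Adj T c y
      cy = ecc-minimal-adjacent c-min (∈A⇒min y∈A) (≢-sym y≢c)
      A⊆ : A ⊆ edge c y
      A⊆ {x} x∈A with x ≟ᶠ c | x ≟ᶠ y
      ... | yes x≡c | _       = ∈edge⁺ (inj₁ x≡c)
      ... | no _    | yes x≡y = ∈edge⁺ (inj₂ x≡y)
      ... | no x≢c  | no x≢y  = ⊥-elim (no-triangle xc cy yx)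
        where
        xc : Adj T x c
        xc = ecc-minimal-adjacent (∈A⇒min x∈A) c-min x≢c
        yx : Adj T y x
        yx = ecc-minimal-adjacent (∈A⇒min y∈A) (∈A⇒min x∈A) (≢-sym x≢y)
      ⊆A : edge c y ⊆ A
      ⊆A x∈ with ∈edge⁻ x∈
      ... | inj₁ refl = c∈A
      ... | inj₂ refl = y∈A

  center-set-shape : ∀ {A} → IsCenterSet T A →
                     (∃ λ c → A ≡ ⁅ c ⁆) ⊎ (∃₂ λ c y → Adj T c y × A ≡ edge c y)
  center-set-shape (S , nonempty , A-center) = CenterSetShape.shape S nonempty A-center

module Enumeration {m : ℕ} (T : Graph (suc m)) (tree : IsTree T) where
  open Tree T tree
  open Levels zero
  open ≡-Reasoning

  private variable
    u v : Fin (suc m)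
    i j : Fin m

  parent-of : ∀ v → v ≢ zero → ∃ λ p → Adj T v p × depth v ≡ suc (depth p)
  parent-of v v≢0 with depth v in eq
  ... | zero  = contradiction (dist≡0⇒≡ eq) v≢0
  ... | suc _ with next-hop eq
  ...   | p , vp , dp = p , vp , cong suc (sym dp)

  parent : Fin m → Fin (suc m)
  parent i = proj₁ (parent-of (suc i) λ ())

  parent-adj : ∀ i → Adj T (suc i) (parent i)
  parent-adj i = proj₁ (proj₂ (parent-of (suc i) λ ()))

  parent-depth : ∀ i → depth (suc i) ≡ suc (depth (parent i))
  parent-depth i = proj₂ (proj₂ (parent-of (suc i) λ ()))

  edgeAt : Fin m → Subset (suc m)
  edgeAt i = edge (suc i) (parent i)

  edgeAt-injective : edgeAt i ≡ edgeAt j → i ≡ j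
  edgeAt-injective {i} {j} eq with ∈edge⁻ (subst (suc i ∈_) eq (∈edge⁺ (inj₁ refl)))
                                 | ∈edge⁻ (subst (suc j ∈_) (sym eq) (∈edge⁺ (inj₁ refl)))
  ... | inj₁ i≡j  | _         = Fin.suc-injective i≡j
  ... | inj₂ _    | inj₁ j≡i  = sym (Fin.suc-injective j≡i)
  ... | inj₂ i≡pj | inj₂ j≡pi = contradiction depth-i≡2+depth-i (m≢1+n+m (depth (suc i)) {1})
    where
    -- suc i and suc j would each be the other's parent.
    depth-i≡2+depth-i : depth (suc i) ≡ suc (suc (depth (suc i)))
    depth-i≡2+depth-i = begin
      depth (suc i)                    ≡⟨ parent-depth i ⟩
      suc (depth (parent i))           ≡⟨ cong (λ t → 1 + depth t) (sym j≡pi) ⟩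
      suc (depth (suc j))              ≡⟨ cong suc (parent-depth j) ⟩
      suc (suc (depth (parent j)))     ≡⟨ cong (λ t → 2 + depth t) (sym i≡pj) ⟩
      suc (suc (depth (suc i)))        ∎

  singleton≢edgeAt : ∀ v i → ⁅ v ⁆ ≢ edgeAt i
  singleton≢edgeAt v i eq = adj⇒≢ T (parent-adj i)
    (trans (at-v (∈edge⁺ (inj₁ refl))) (sym (at-v (∈edge⁺ (inj₂ refl)))))
    where
    at-v : ∀ {x} → x ∈ edgeAt i → x ≡ v
    at-v x∈ = x∈⁅y⁆⇒x≡y v (subst (_ ∈_) (sym eq) x∈)

  edge-from-child : Adj T v u → depth v ≡ suc (depth u) → ∃ λ i → edge v u ≡ edgeAt i
  edge-from-child {zero}  _  dv = contradiction (trans (sym dist-self) dv) 0≢1+n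
  edge-from-child {suc i} vu dv =
    i , cong (edge (suc i))
             (parent-unique vu (parent-adj i) refl (suc-injective (trans (sym (parent-depth i)) dv)) dv)

  edge-enumerated : Adj T u v → ∃ λ i → edge u v ≡ edgeAt i
  edge-enumerated {u} {v} uv with depth-step uv
  ... | inj₁ v-deeper =
    Product.map₂ (trans (edge-comm u v)) (edge-from-child (symAdj T uv) v-deeper)
  ... | inj₂ u-deeper = edge-from-child uv u-deeper

  centerSets : List (Subset (suc m))
  centerSets = map ⁅_⁆ (allFin (suc m)) ++ map edgeAt (allFin m)

  centerSets-unique : Unique centerSets
  centerSets-unique = Uniqueₚ.++⁺
    (Uniqueₚ.map⁺ (λ {u v} → ⁅⁆-injective {u = u} {v}) (Uniqueₚ.allFin⁺ (suc m)))
    (Uniqueₚ.map⁺ (λ {i j} → edgeAt-injective {i} {j}) (Uniqueₚ.allFin⁺ m))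
    singletons-disjoint-edges
    where
    singletons-disjoint-edges : ∀ {A} →
                                ¬ (A ∈ₗ map ⁅_⁆ (allFin (suc m)) × A ∈ₗ map edgeAt (allFin m))
    singletons-disjoint-edges (∈singletons , ∈edges)
      with ∈-map⁻ ⁅_⁆ {xs = allFin (suc m)} ∈singletons | ∈-map⁻ edgeAt ∈edges
    ... | v , _ , refl | i , _ , eq = singleton≢edgeAt v i eq

  centerSets-length : length centerSets ≡ 2 * suc m ∸ 1
  centerSets-length = begin
    length centerSets
      ≡⟨ length-++ (map ⁅_⁆ (allFin (suc m))) ⟩
    length (map ⁅_⁆ (allFin (suc m))) + length (map edgeAt (allFin m))
      ≡⟨ cong₂ _+_ (length-map-allFin ⁅_⁆) (length-map-allFin edgeAt) ⟩
    suc m + m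
      ≡⟨ sym (+-suc m m) ⟩
    m + suc m
      ≡⟨ cong (λ k → m + suc k) (sym (+-identityʳ m)) ⟩
    2 * suc m ∸ 1 ∎
    where
    length-map-allFin : ∀ {k} {B : Set} (f : Fin k → B) → length (map f (allFin k)) ≡ k
    length-map-allFin {k} f = trans (length-map f (allFin k)) (length-tabulate id)

  ∈centerSets⇔ : ∀ A → A ∈ₗ centerSets ⇔ IsCenterSet T A
  ∈centerSets⇔ A = mk⇔ to from
    where
    to : A ∈ₗ centerSets → IsCenterSet T A
    to A∈ with ∈-++⁻ (map ⁅_⁆ (allFin (suc m))) A∈
    ... | inj₁ A∈singletons with ∈-map⁻ ⁅_⁆ {xs = allFin (suc m)} A∈singletons
    ...   | v , _ , refl = ⁅ v ⁆ , (v , x∈⁅x⁆ v) , singleton-center v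
    to A∈ | inj₂ A∈edges with ∈-map⁻ edgeAt A∈edges
    ...   | i , _ , refl = edgeAt i , (suc i , ∈edge⁺ (inj₁ refl)) , edge-center (parent-adj i)
    from : IsCenterSet T A → A ∈ₗ centerSets
    from A-center with center-set-shape A-center
    ... | inj₁ (c , refl) = ∈-++⁺ˡ {ys = map edgeAt (allFin m)} (∈-map⁺ ⁅_⁆ (∈-allFin c))
    ... | inj₂ (c , y , cy , refl) with edge-enumerated cy
    ...   | i , eq =
      ∈-++⁺ʳ (map ⁅_⁆ (allFin (suc m))) (subst (_∈ₗ _) (sym eq) (∈-map⁺ edgeAt (∈-allFin i)))

mainTheorem19 : (n : ℕ) (T : Graph n) → IsTree T → CenterNumber T (2 * n ∸ 1)
mainTheorem19 zero    T _    = [] , [] , refl , λ A → mk⇔ (λ ()) λ { (_ , (() , _) , _) }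
mainTheorem19 (suc m) T tree = centerSets , centerSets-unique , centerSets-length , ∈centerSets⇔
  where open Enumeration T tree
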